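{- For all integers $n\geq 1$, $\Delta_1(n)=0$. For all integers $\ell>1$, $\Delta_\ell(1)<0$ and $\Delta_\ell(2)>0$. Moreover, $\Delta_\ell(3)<0$ for $2\le\ell\le 13$ and $\Delta_\ell(3)>0$ for $\ell\geq 14$.
   Context: For integers $\ell\geq 1$ and $n\geq 1$, let $C_{\ell,n}=\{(\pi_1,\dots,\pi_\ell)\in S_n^\ell : \pi_j\pi_k=\pi_k\pi_j \text{ for all } j,k\}$, where $S_n$ is the symmetric group on $n$ letters, and $N_\ell(n)=|C_{\ell,n}|/n!$, with $N_\ell(0)=1$. Define $\Delta_\ell(n)=N_\ell(n)^2-N_\ell(n-1)N_\ell(n+1)$. -}

module Defs where

open import Data.Bool using (Bool; true; false; _∧_; _∨_; not)
open import Data.Nat using (ℕ; zero; suc; _∸_; _!)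
open import Data.Nat.Properties using (_!≢0)
open import Data.Fin as Fin using (Fin)
open import Data.List using (List; []; _∷_; [_]; map; concatMap; allFin; filterᵇ; length)
open import Data.Bool.ListAction using (and)
open import Data.Vec as Vec using (Vec; lookup; tabulate)
open import Data.Vec.Properties using (≡-dec)
open import Data.Integer using (+_)
open import Data.Rational using (ℚ; _/_; _*_; _-_; 1ℚ)
open import Relation.Nullary.Decidable using (⌊_⌋)

allᵇ : {A : Set} → (A → Bool) → List A → Bool
allᵇ p xs = and (map p xs)

allVecs : {A : Set} → List A → (k : ℕ) → List (Vec A k)
allVecs xs zero = [ Vec.[] ]
allVecs xs (suc k) = concatMap (λ x → map (x Vec.∷_) (allVecs xs k)) xs

-- A self-map of {0,…,n-1}, represented by its table of values.
Fun : ℕ → Set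
Fun n = Vec (Fin n) n

_∘ₚ_ : {n : ℕ} → Fun n → Fun n → Fun n
f ∘ₚ g = tabulate (λ i → lookup f (lookup g i))

-- Injectivity (equivalently bijectivity, on a finite set).
isInjective : {n : ℕ} → Fun n → Bool
isInjective {n} f =
  allᵇ (λ i → allᵇ (λ j → not ⌊ lookup f i Fin.≟ lookup f j ⌋ ∨ ⌊ i Fin.≟ j ⌋) (allFin n)) (allFin n)

Sym : (n : ℕ) → List (Fun n)
Sym n = filterᵇ isInjective (allVecs (allFin n) n)

commuteᵇ : {n : ℕ} → Fun n → Fun n → Bool
commuteᵇ f g = ⌊ ≡-dec Fin._≟_ (f ∘ₚ g) (g ∘ₚ f) ⌋

pairwiseCommuting : {ℓ n : ℕ} → Vec (Fun n) ℓ → Bool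
pairwiseCommuting {ℓ} t =
  allᵇ (λ j → allᵇ (λ k → commuteᵇ (lookup t j) (lookup t k)) (allFin ℓ)) (allFin ℓ)

cardC : (ℓ n : ℕ) → ℕ
cardC ℓ n = length (filterᵇ pairwiseCommuting (allVecs (Sym n) ℓ))

N : (ℓ n : ℕ) → ℚ
N ℓ zero = 1ℚ
N ℓ n@(suc _) = ((+ cardC ℓ n) / (n !)) {{n !≢0}}

-- Δ_ℓ(n) = N_ℓ(n)^2 − N_ℓ(n−1) N_ℓ(n+1)   (used only for n ≥ 1)
Δ : (ℓ n : ℕ) → ℚ
Δ ℓ n = N ℓ n * N ℓ n - N ℓ (n ∸ 1) * N ℓ (suc n)

-- Counting commuting tuples by their first entry gives, for a list L of permutations,
-- c_L(k+1) = Σ_{x ∈ L} c_{Z_L(x)}(k), where c_L(k) is the number of commuting k-tuples from L and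
-- Z_L(x) is the centralizer of x in L. For n ≤ 4 every iterated centralizer in S_n is abelian, S₃, D₄
-- or S₄, and solving the recursion gives |C_{ℓ,0}| = |C_{ℓ,1}| = 1, |C_{ℓ,2}| = 2^ℓ,
-- |C_{ℓ,3}| = 3·2^ℓ + 3^ℓ − 3 and |C_{ℓ,4}| = 7·4^ℓ + 4·3^ℓ − 6·2^ℓ − 4; these closed forms are checked by
-- evaluating a certificate for the recursion. As N_ℓ(n) = |C_{ℓ,n}|/n!, the sign of Δ_ℓ(n) is that of
-- |C_{ℓ,n}|²(n−1)!(n+1)! − |C_{ℓ,n−1}||C_{ℓ,n+1}|n!², an integer exponential polynomial in ℓ:
-- 2 − 2^ℓ for n = 1, 6·4^ℓ − 4·3^ℓ − 12·2^ℓ + 12 for n = 2, and for n = 3 twelve times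
-- 4·9^ℓ − 21·8^ℓ + 12·6^ℓ + 54·4^ℓ − 24·3^ℓ − 60·2^ℓ + 36, whose leading terms trade places between
-- ℓ = 13 and ℓ = 14. For ℓ = 1 every 1-tuple commutes, so N_1(n) = n!/n! = 1.

module Submission where

open import Defs
open import Data.Nat using (ℕ; _≤_; _<_)
open import Data.Product using (_×_)
open import Data.Rational using (0ℚ) renaming (_<_ to _<ℚ_)
open import Relation.Binary.PropositionalEquality using (_≡_)

open import Data.Bool using (Bool; true; false; _∧_; _∨_; not; if_then_else_)
open import Data.Bool.ListAction using (and)
open import Data.Bool.Properties using (∧-assoc; ∧-idem; ∧-zeroʳ; ∨-zeroʳ; ∨-identityʳ)
open import Data.Empty using (⊥)
open import Data.Fin as Fin using (Fin; zero; suc; toℕ; fromℕ<)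
import Data.Fin.Properties as Fin
open import Data.Integer as ℤ using (ℤ; +_; 0ℤ; +<+)
open import Data.Integer.Properties as ℤ using (pos-+; pos-*)
open import Data.Integer.Tactic.RingSolver using (solve-∀)
open import Data.List using (List; []; _∷_; map; foldr; concatMap; allFin; filterᵇ; length; _++_)
open import Data.List.Membership.Propositional using (_∈_)
open import Data.List.Properties using (map-tabulate; map-cong; length-tabulate; filter-all)
  renaming (≡-dec to ≡-decList)
open import Data.List.Relation.Unary.All as All using (All; []; _∷_)
open import Data.List.Relation.Unary.AllPairs using (_∷_)
open import Data.List.Relation.Unary.Any using (here; there)
open import Data.List.Relation.Unary.Unique.Propositional using (Unique)
import Data.List.Relation.Unary.Unique.Propositional.Properties as Unique
open import Data.Nat using (zero; suc; _+_; _*_; _^_; _∸_; pred; _!; _≡ᵇ_; NonZero; s≤s)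
open import Data.Nat.ListAction using (sum)
open import Data.Nat.Properties
  using (_!≢0; ^-zeroˡ; ^-monoʳ-≤; *-monoʳ-<; *-monoʳ-≤; *-monoˡ-≤; +-monoʳ-≤; m≤m+n; m≤n⇒m<n∨m≡n;
         <-≤-trans; ≤-trans; ≤-reflexive; <⇒≤; <ᵇ⇒<; ≤ᵇ⇒≤; m+[n∸m]≡n; ∸-monoˡ-≤; module ≤-Reasoning)
import Data.Nat.Tactic.RingSolver as ℕ-Ring
open import Data.Product using (_,_)
open import Data.Rational as ℚ using (1ℚ; toℚᵘ)
open import Data.Rational.Properties using (toℚᵘ-fromℚᵘ; toℚᵘ-homo-*; toℚᵘ-cancel-<; toℚᵘ-injective; +-inverseʳ; +-monoˡ-<)
open import Data.Rational.Unnormalised as ℚᵘ using (*≡*; *<*) renaming (_≃_ to _≃ᵘ_)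
open import Data.Rational.Unnormalised.Properties as ℚᵘ using (≃-trans; ≃-sym; <-respˡ-≃; <-respʳ-≃)
open import Data.Sum using (_⊎_; inj₁; inj₂)
open import Data.Vec using (Vec; []; _∷_; lookup; zipWith; replicate)
open import Data.Vec.Properties using (≡-dec)
open import Function using (_∘_; id; mk⇔)
open import Relation.Binary.Definitions using (DecidableEquality)
open import Relation.Binary.PropositionalEquality using (refl; sym; trans; cong; cong₂; subst; subst₂; module ≡-Reasoning)
open import Relation.Nullary.Decidable
  using (Dec; yes; no; ⌊_⌋; T?; _×-dec_; _⊎-dec_; from-yes; isYes≗does; dec-true; does-⇔; ⌊⌋-map′; fromWitnessFalse)
open import Relation.Nullary.Negation using (contradiction)

private variable
  A B : Set

⌊≟⌋-refl : (_≟_ : DecidableEquality A) (x : A) → ⌊ x ≟ x ⌋ ≡ true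
⌊≟⌋-refl _≟_ x = trans (isYes≗does (x ≟ x)) (dec-true (x ≟ x) refl)

⌊≟⌋-sym : (_≟_ : DecidableEquality A) (x y : A) → ⌊ x ≟ y ⌋ ≡ ⌊ y ≟ x ⌋
⌊≟⌋-sym _≟_ x y = begin
  ⌊ x ≟ y ⌋   ≡⟨ isYes≗does (x ≟ y) ⟩
  _           ≡⟨ does-⇔ (mk⇔ sym sym) (x ≟ y) (y ≟ x) ⟩
  _           ≡⟨ isYes≗does (y ≟ x) ⟨
  ⌊ y ≟ x ⌋   ∎
  where open ≡-Reasoning

allᵇ-cong : {p q : A → Bool} → (∀ x → p x ≡ q x) → ∀ xs → allᵇ p xs ≡ allᵇ q xs
allᵇ-cong p≗q xs = cong and (map-cong p≗q xs)

allᵇ-∧ : (p q : A → Bool) (xs : List A) → allᵇ (λ x → p x ∧ q x) xs ≡ (allᵇ p xs ∧ allᵇ q xs)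
allᵇ-∧ p q []       = refl
allᵇ-∧ p q (x ∷ xs) with p x | q x
... | true  | true  = allᵇ-∧ p q xs
... | true  | false = sym (∧-zeroʳ (allᵇ p xs))
... | false | _     = refl

allᵇ-allFin-suc : ∀ {k} (p : Fin (suc k) → Bool) →
                  allᵇ p (allFin (suc k)) ≡ (p zero ∧ allᵇ (p ∘ suc) (allFin k))
allᵇ-allFin-suc p = cong (λ bs → p zero ∧ and bs)
  (trans (map-tabulate suc p) (sym (map-tabulate id (p ∘ suc))))

allPairs : ∀ {k} → (Fin k → Fin k → Bool) → Bool
allPairs {k} R = allᵇ (λ i → allᵇ (R i) (allFin k)) (allFin k)

allPairs-suc : ∀ {k} (R : Fin (suc k) → Fin (suc k) → Bool) →
               R zero zero ≡ true → (∀ i → R (suc i) zero ≡ R zero (suc i)) →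
               allPairs R ≡ (allᵇ (R zero ∘ suc) (allFin k) ∧ allPairs (λ i j → R (suc i) (suc j)))
allPairs-suc {k} R R₀₀ R-sym = begin
  allPairs R
    ≡⟨ allᵇ-allFin-suc (λ i → allᵇ (R i) (allFin (suc k))) ⟩
  allᵇ (R zero) (allFin (suc k)) ∧ allᵇ (λ i → allᵇ (R (suc i)) (allFin (suc k))) (allFin k)
    ≡⟨ cong₂ _∧_ (allᵇ-allFin-suc (R zero)) (allᵇ-cong (λ i → allᵇ-allFin-suc (R (suc i))) (allFin k)) ⟩
  (R zero zero ∧ row) ∧ allᵇ (λ i → R (suc i) zero ∧ allᵇ (R (suc i) ∘ suc) (allFin k)) (allFin k)
    ≡⟨ cong₂ _∧_ (cong (_∧ row) R₀₀) (allᵇ-∧ _ _ (allFin k)) ⟩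
  row ∧ (allᵇ (λ i → R (suc i) zero) (allFin k) ∧ rest)
    ≡⟨ cong (λ b → row ∧ (b ∧ rest)) (allᵇ-cong R-sym (allFin k)) ⟩
  row ∧ (row ∧ rest)
    ≡⟨ ∧-assoc row row rest ⟨
  (row ∧ row) ∧ rest
    ≡⟨ cong (_∧ rest) (∧-idem row) ⟩
  row ∧ rest ∎
  where
  open ≡-Reasoning
  row  = allᵇ (R zero ∘ suc) (allFin k)
  rest = allPairs (λ i j → R (suc i) (suc j))

-- Counting tuples

count : (A → Bool) → List A → ℕ
count p xs = length (filterᵇ p xs)

count-cong : {p q : A → Bool} → (∀ x → p x ≡ q x) → ∀ xs → count p xs ≡ count q xs
count-cong {p = p} {q} p≗q []       = refl
count-cong {p = p} {q} p≗q (x ∷ xs) with p x | q x | p≗q x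
... | true  | true  | _ = cong suc (count-cong p≗q xs)
... | false | false | _ = count-cong p≗q xs

count-false : (xs : List A) → count (λ _ → false) xs ≡ 0
count-false []       = refl
count-false (x ∷ xs) = count-false xs

count-map : (p : B → Bool) (f : A → B) (xs : List A) → count p (map f xs) ≡ count (p ∘ f) xs
count-map p f []       = refl
count-map p f (x ∷ xs) with p (f x)
... | true  = cong suc (count-map p f xs)
... | false = count-map p f xs

count-++ : (p : A → Bool) (xs ys : List A) → count p (xs ++ ys) ≡ count p xs + count p ys
count-++ p []       ys = refl
count-++ p (x ∷ xs) ys with p x
... | true  = cong suc (count-++ p xs ys)
... | false = count-++ p xs ys

sum-map-cong : {f g : A → ℕ} → (∀ x → f x ≡ g x) → ∀ xs → sum (map f xs) ≡ sum (map g xs)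
sum-map-cong f≗g xs = cong sum (map-cong f≗g xs)

sum-map-filter : (p : A → Bool) (f : A → ℕ) (xs : List A) →
                 sum (map (λ x → if p x then f x else 0) xs) ≡ sum (map f (filterᵇ p xs))
sum-map-filter p f []       = refl
sum-map-filter p f (x ∷ xs) with p x
... | true  = cong (λ s → f x + s) (sum-map-filter p f xs)
... | false = sum-map-filter p f xs

count-allVecs-suc : ∀ {k} (p : Vec A (suc k) → Bool) (xs : List A) →
                    count p (allVecs xs (suc k)) ≡ sum (map (λ x → count (p ∘ (x ∷_)) (allVecs xs k)) xs)
count-allVecs-suc {k = k} p xs = go xs
  where
  go : ∀ ys → count p (concatMap (λ x → map (x ∷_) (allVecs xs k)) ys)
            ≡ sum (map (λ x → count (p ∘ (x ∷_)) (allVecs xs k)) ys)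
  go []       = refl
  go (y ∷ ys) = trans (count-++ p (map (y ∷_) (allVecs xs k)) _)
                      (cong₂ _+_ (count-map p (y ∷_) (allVecs xs k)) (go ys))

count-allVecs-restrict : (p : A → Bool) (xs : List A) (k : ℕ) (q : Vec A k → Bool) →
  count (λ t → allᵇ (p ∘ lookup t) (allFin k) ∧ q t) (allVecs xs k) ≡ count q (allVecs (filterᵇ p xs) k)
count-allVecs-restrict p xs zero    q = refl
count-allVecs-restrict p xs (suc k) q = begin
  count (λ t → allᵇ (p ∘ lookup t) (allFin (suc k)) ∧ q t) (allVecs xs (suc k))
    ≡⟨ count-allVecs-suc _ xs ⟩
  sum (map (λ x → count (λ t → allᵇ (p ∘ lookup (x ∷ t)) (allFin (suc k)) ∧ q (x ∷ t)) (allVecs xs k)) xs)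
    ≡⟨ sum-map-cong (λ x → by-head x (p x) refl) xs ⟩
  sum (map (λ x → if p x then count (q ∘ (x ∷_)) (allVecs (filterᵇ p xs) k) else 0) xs)
    ≡⟨ sum-map-filter p _ xs ⟩
  sum (map (λ x → count (q ∘ (x ∷_)) (allVecs (filterᵇ p xs) k)) (filterᵇ p xs))
    ≡⟨ count-allVecs-suc q (filterᵇ p xs) ⟨
  count q (allVecs (filterᵇ p xs) (suc k)) ∎
  where
  open ≡-Reasoning
  by-head : ∀ x b → p x ≡ b →
    count (λ t → allᵇ (p ∘ lookup (x ∷ t)) (allFin (suc k)) ∧ q (x ∷ t)) (allVecs xs k)
      ≡ (if b then count (q ∘ (x ∷_)) (allVecs (filterᵇ p xs) k) else 0)
  by-head x b px≡b = trans (count-cong split (allVecs xs k)) (by-cases b)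
    where
    split : ∀ t → (allᵇ (p ∘ lookup (x ∷ t)) (allFin (suc k)) ∧ q (x ∷ t))
                ≡ (b ∧ (allᵇ (p ∘ lookup t) (allFin k) ∧ q (x ∷ t)))
    split t = trans (cong (_∧ q (x ∷ t)) (trans (allᵇ-allFin-suc (p ∘ lookup (x ∷ t))) (cong (_∧ _) px≡b)))
                    (∧-assoc b _ _)
    by-cases : ∀ b → count (λ t → b ∧ (allᵇ (p ∘ lookup t) (allFin k) ∧ q (x ∷ t))) (allVecs xs k)
                   ≡ (if b then count (q ∘ (x ∷_)) (allVecs (filterᵇ p xs) k) else 0)
    by-cases true  = count-allVecs-restrict p xs k (q ∘ (x ∷_))
    by-cases false = count-false (allVecs xs k)

count-allVecs-∷ : (q : ∀ {k} → Vec A k → Bool) (r : A → A → Bool) →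
  (∀ {k} x (t : Vec A k) → q (x ∷ t) ≡ (allᵇ (r x ∘ lookup t) (allFin k) ∧ q t)) →
  ∀ xs k → count q (allVecs xs (suc k)) ≡ sum (map (λ x → count q (allVecs (filterᵇ (r x) xs) k)) xs)
count-allVecs-∷ q r q-∷ xs k = trans (count-allVecs-suc q xs) (sum-map-cong (λ x →
  trans (count-cong (q-∷ x) (allVecs xs k)) (count-allVecs-restrict (r x) xs k q)) xs)

centralizer : ∀ {n} → Fun n → List (Fun n) → List (Fun n)
centralizer x = filterᵇ (commuteᵇ x)

commutingCount : ∀ {n} → List (Fun n) → ℕ → ℕ
commutingCount L k = count pairwiseCommuting (allVecs L k)

pairwiseCommuting-∷ : ∀ {n k} (x : Fun n) (t : Vec (Fun n) k) →
  pairwiseCommuting (x ∷ t) ≡ (allᵇ (commuteᵇ x ∘ lookup t) (allFin k) ∧ pairwiseCommuting t)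
pairwiseCommuting-∷ x t = allPairs-suc _ (⌊≟⌋-refl (≡-dec Fin._≟_) (x ∘ₚ x))
  (λ i → ⌊≟⌋-sym (≡-dec Fin._≟_) (lookup t i ∘ₚ x) (x ∘ₚ lookup t i))

commutingCount-suc : ∀ {n} (L : List (Fun n)) k →
  commutingCount L (suc k) ≡ sum (map (λ x → commutingCount (centralizer x L) k) L)
commutingCount-suc = count-allVecs-∷ pairwiseCommuting commuteᵇ pairwiseCommuting-∷

commutingCount-one : ∀ {n} (L : List (Fun n)) → commutingCount L 1 ≡ length L
commutingCount-one L = trans (commutingCount-suc L 0) (ones L)
  where
  ones : ∀ M → sum (map (λ x → commutingCount (centralizer x L) 0) M) ≡ length M
  ones []      = refl
  ones (_ ∷ M) = cong suc (ones M)

_≠ᵇ_ : ∀ {m} → Fin m → Fin m → Bool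
x ≠ᵇ y = not ⌊ x Fin.≟ y ⌋

allDistinct : ∀ {m k} → Vec (Fin m) k → Bool
allDistinct v = allPairs (λ i j → lookup v i ≠ᵇ lookup v j ∨ ⌊ i Fin.≟ j ⌋)

allDistinct-∷ : ∀ {m k} (x : Fin m) (v : Vec (Fin m) k) →
  allDistinct (x ∷ v) ≡ (allᵇ ((x ≠ᵇ_) ∘ lookup v) (allFin k) ∧ allDistinct v)
allDistinct-∷ {k = k} x v = begin
  allDistinct (x ∷ v)
    ≡⟨ allPairs-suc _ (∨-zeroʳ (x ≠ᵇ x))
         (λ i → cong (λ b → not b ∨ false) (⌊≟⌋-sym Fin._≟_ (lookup v i) x)) ⟩
  allᵇ (λ j → x ≠ᵇ lookup v j ∨ false) (allFin k)
    ∧ allPairs (λ i j → lookup v i ≠ᵇ lookup v j ∨ ⌊ suc i Fin.≟ suc j ⌋)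
    ≡⟨ cong₂ _∧_ (allᵇ-cong (λ j → ∨-identityʳ (x ≠ᵇ lookup v j)) (allFin k))
                 (allᵇ-cong (λ i → allᵇ-cong (λ j → cong (lookup v i ≠ᵇ lookup v j ∨_)
                    (⌊⌋-map′ _ _ (i Fin.≟ j))) (allFin k)) (allFin k)) ⟩
  allᵇ ((x ≠ᵇ_) ∘ lookup v) (allFin k) ∧ allDistinct v ∎
  where open ≡-Reasoning

fallingFactorial : ℕ → ℕ → ℕ
fallingFactorial m zero    = 1
fallingFactorial m (suc k) = m * fallingFactorial (pred m) k

fallingFactorial-diag : ∀ n → fallingFactorial n n ≡ n !
fallingFactorial-diag zero    = refl
fallingFactorial-diag (suc n) = cong (suc n *_) (fallingFactorial-diag n)

length-filter-≠ : ∀ {m} (x : Fin m) (L : List (Fin m)) → Unique L → x ∈ L →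
                  length (filterᵇ (x ≠ᵇ_) L) ≡ pred (length L)
length-filter-≠ x (x ∷ L) (x∉L ∷ _) (here refl)
  rewrite ⌊≟⌋-refl Fin._≟_ x = cong length (filter-all (T? ∘ (x ≠ᵇ_)) (All.map fromWitnessFalse x∉L))
length-filter-≠ x (y ∷ L) (y∉L ∷ uL) (there x∈L) with x Fin.≟ y
... | yes refl = contradiction refl (All.lookup y∉L x∈L)
... | no  _    = trans (cong suc (length-filter-≠ x L uL x∈L)) (suc-pred-length x∈L)
  where
  suc-pred-length : ∀ {M : List (Fin _)} → x ∈ M → suc (pred (length M)) ≡ length M
  suc-pred-length (here _)  = refl
  suc-pred-length (there _) = refl

distinctCount : ∀ {m} k (L : List (Fin m)) → Unique L →
                count allDistinct (allVecs L k) ≡ fallingFactorial (length L) k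
distinctCount zero    L uL = refl
distinctCount (suc k) L uL = begin
  count allDistinct (allVecs L (suc k))
    ≡⟨ count-allVecs-∷ allDistinct _≠ᵇ_ allDistinct-∷ L k ⟩
  sum (map (λ x → count allDistinct (allVecs (filterᵇ (x ≠ᵇ_) L) k)) L)
    ≡⟨ sum-map-const-on L (λ x x∈L → trans (distinctCount k _ (Unique.filter⁺ _ uL))
                                          (cong (λ l → fallingFactorial l k) (length-filter-≠ x L uL x∈L))) ⟩
  length L * fallingFactorial (pred (length L)) k ∎
  where
  open ≡-Reasoning
  sum-map-const-on : ∀ {f : Fin _ → ℕ} {c} M → (∀ x → x ∈ M → f x ≡ c) → sum (map f M) ≡ length M * c
  sum-map-const-on []      f≡c = refl
  sum-map-const-on (x ∷ M) f≡c = cong₂ _+_ (f≡c x (here refl)) (sum-map-const-on M (λ y → f≡c y ∘ there))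

length-Sym : ∀ n → length (Sym n) ≡ n !
length-Sym n = begin
  count allDistinct (allVecs (allFin n) n)   ≡⟨ distinctCount n (allFin n) (Unique.allFin⁺ n) ⟩
  fallingFactorial (length (allFin n)) n     ≡⟨ cong (λ l → fallingFactorial l n) (length-tabulate id) ⟩
  fallingFactorial n n                       ≡⟨ fallingFactorial-diag n ⟩
  n ! ∎
  where open ≡-Reasoning

-- Closed forms for n ≤ 4

evalExp : ∀ {m} → Vec ℕ m → Vec ℤ m → ℕ → ℤ
evalExp []       []       k = 0ℤ
evalExp (b ∷ bs) (c ∷ cs) k = c ℤ.* + (b ^ k) ℤ.+ evalExp bs cs k

evalExp-zero : ∀ {m} (bs : Vec ℕ m) k → evalExp bs (replicate m 0ℤ) k ≡ 0ℤ
evalExp-zero []       k = refl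
evalExp-zero (b ∷ bs) k = trans (ℤ.+-identityˡ (evalExp bs _ k)) (evalExp-zero bs k)

evalExp-+ : ∀ {m} (bs : Vec ℕ m) (cs ds : Vec ℤ m) k →
            evalExp bs (zipWith ℤ._+_ cs ds) k ≡ evalExp bs cs k ℤ.+ evalExp bs ds k
evalExp-+ []       []       []       k = refl
evalExp-+ (b ∷ bs) (c ∷ cs) (d ∷ ds) k =
  trans (cong (λ e → (c ℤ.+ d) ℤ.* + (b ^ k) ℤ.+ e) (evalExp-+ bs cs ds k))
        (interchange c d (+ (b ^ k)) (evalExp bs cs k) (evalExp bs ds k))
  where
  interchange : ∀ c d x u v → (c ℤ.+ d) ℤ.* x ℤ.+ (u ℤ.+ v) ≡ (c ℤ.* x ℤ.+ u) ℤ.+ (d ℤ.* x ℤ.+ v)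
  interchange = solve-∀

evalExp-suc : ∀ {m} (bs : Vec ℕ m) (cs : Vec ℤ m) k →
              evalExp bs (zipWith (λ b c → + b ℤ.* c) bs cs) k ≡ evalExp bs cs (suc k)
evalExp-suc []       []       k = refl
evalExp-suc (b ∷ bs) (c ∷ cs) k = cong₂ ℤ._+_
  (trans (reassoc (+ b) c (+ (b ^ k))) (cong (c ℤ.*_) (sym (pos-* b (b ^ k)))))
  (evalExp-suc bs cs k)
  where
  reassoc : ∀ b c x → b ℤ.* c ℤ.* x ≡ c ℤ.* (b ℤ.* x)
  reassoc = solve-∀

-- Certified d L checks, on coefficient vectors, that closedForm satisfies the recursion commutingCount-suc
-- at L and, to depth d, at its centralizers; a centralizer equal to L (x central) refers back to L itself.
module Certificate {n m : ℕ} (bases : Vec ℕ m) (closedForm : List (Fun n) → Vec ℤ m) where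

  sumCoeffs : List (Vec ℤ m) → Vec ℤ m
  sumCoeffs = foldr (zipWith ℤ._+_) (replicate m 0ℤ)

  shift : Vec ℤ m → Vec ℤ m
  shift = zipWith (λ b c → + b ℤ.* c) bases

  Consistent : List (Fun n) → Set
  Consistent L = sumCoeffs (map (λ x → closedForm (centralizer x L)) L) ≡ shift (closedForm L)
               × evalExp bases (closedForm L) 0 ≡ + 1

  Certified : ℕ → List (Fun n) → Set
  Certified zero    L = ⊥
  Certified (suc d) L = Consistent L × All (λ x → centralizer x L ≡ L ⊎ Certified d (centralizer x L)) L

  certified? : ∀ d L → Dec (Certified d L)
  certified? zero    L = no λ ()
  certified? (suc d) L = (≡-dec ℤ._≟_ _ _ ×-dec evalExp bases (closedForm L) 0 ℤ.≟ + 1)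
    ×-dec All.all? (λ x → ≡-decList (≡-dec Fin._≟_) (centralizer x L) L ⊎-dec certified? d (centralizer x L)) L

  sum-evalExp : (f : A → ℕ) (g : A → Vec ℤ m) {xs : List A} (k : ℕ) →
    All (λ x → + f x ≡ evalExp bases (g x) k) xs → + sum (map f xs) ≡ evalExp bases (sumCoeffs (map g xs)) k
  sum-evalExp f g k []                  = sym (evalExp-zero bases k)
  sum-evalExp f g {x ∷ xs} k (fx ∷ fxs) = begin
    + (f x + sum (map f xs))                                         ≡⟨ pos-+ (f x) _ ⟩
    + f x ℤ.+ + sum (map f xs)                                       ≡⟨ cong₂ ℤ._+_ fx (sum-evalExp f g k fxs) ⟩
    evalExp bases (g x) k ℤ.+ evalExp bases (sumCoeffs (map g xs)) k ≡⟨ evalExp-+ bases _ _ k ⟨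
    evalExp bases (sumCoeffs (map g (x ∷ xs))) k                     ∎
    where open ≡-Reasoning

  commutingCount-closedForm : ∀ d L → Certified d L → ∀ k → + commutingCount L k ≡ evalExp bases (closedForm L) k
  commutingCount-closedForm (suc d) L ((_ , base) , _) zero = sym base
  commutingCount-closedForm (suc d) L cert@((sums , _) , children) (suc k) = begin
    + commutingCount L (suc k)
      ≡⟨ cong +_ (commutingCount-suc L k) ⟩
    + sum (map (λ x → commutingCount (centralizer x L) k) L)
      ≡⟨ sum-evalExp (λ x → commutingCount (centralizer x L) k) (λ x → closedForm (centralizer x L)) k
                     (All.map (λ {x} → child {x}) children) ⟩
    evalExp bases (sumCoeffs (map (λ x → closedForm (centralizer x L)) L)) k
      ≡⟨ cong (λ cs → evalExp bases cs k) sums ⟩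
    evalExp bases (shift (closedForm L)) k
      ≡⟨ evalExp-suc bases (closedForm L) k ⟩
    evalExp bases (closedForm L) (suc k) ∎
    where
    open ≡-Reasoning
    child : ∀ {x} → centralizer x L ≡ L ⊎ Certified d (centralizer x L) →
            + commutingCount (centralizer x L) k ≡ evalExp bases (closedForm (centralizer x L)) k
    child (inj₁ central) rewrite central = commutingCount-closedForm (suc d) L cert k
    child (inj₂ certified)               = commutingCount-closedForm d _ certified k

-- Coefficients of 1^k, 2^k, 3^k, 4^k in the number of commuting k-tuples of the groups met as iterated
-- centralizers in S_n, n ≤ 4: abelian groups of order m (m^k), S₃, D₄ and S₄, distinguished by their order.
closedFormByOrder : ℕ → Vec ℤ 4
closedFormByOrder 1 = + 1 ∷ 0ℤ ∷ 0ℤ ∷ 0ℤ ∷ []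
closedFormByOrder 2 = 0ℤ ∷ + 1 ∷ 0ℤ ∷ 0ℤ ∷ []
closedFormByOrder 3 = 0ℤ ∷ 0ℤ ∷ + 1 ∷ 0ℤ ∷ []
closedFormByOrder 4 = 0ℤ ∷ 0ℤ ∷ 0ℤ ∷ + 1 ∷ []
closedFormByOrder 6 = ℤ.- + 3 ∷ + 3 ∷ + 1 ∷ 0ℤ ∷ []
closedFormByOrder 8 = 0ℤ ∷ ℤ.- + 2 ∷ 0ℤ ∷ + 3 ∷ []
closedFormByOrder n = if n ≡ᵇ 24 then ℤ.- + 4 ∷ ℤ.- + 6 ∷ + 4 ∷ + 7 ∷ [] else replicate 4 0ℤ

module ByOrder (n : ℕ) = Certificate {n} (1 ∷ 2 ∷ 3 ∷ 4 ∷ []) (closedFormByOrder ∘ length)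

-- Depth 3 is the longest chain S₄ ⊋ D₄ ⊋ V₄ of proper iterated centralizers.
cardC-by-order : ∀ n → ByOrder.Certified n 3 (Sym n) →
  ∀ ℓ → + cardC ℓ n ≡ evalExp (1 ∷ 2 ∷ 3 ∷ 4 ∷ []) (closedFormByOrder (length (Sym n))) ℓ
cardC-by-order n cert = ByOrder.commutingCount-closedForm n 3 (Sym n) cert

evalExp-1234 : ∀ a b c d ℓ → evalExp (1 ∷ 2 ∷ 3 ∷ 4 ∷ []) (a ∷ b ∷ c ∷ d ∷ []) ℓ
                           ≡ a ℤ.+ b ℤ.* + (2 ^ ℓ) ℤ.+ c ℤ.* + (3 ^ ℓ) ℤ.+ d ℤ.* + (4 ^ ℓ)
evalExp-1234 a b c d ℓ rewrite ^-zeroˡ ℓ = flatten a b c d (+ (2 ^ ℓ)) (+ (3 ^ ℓ)) (+ (4 ^ ℓ))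
  where
  flatten : ∀ a b c d x y z → a ℤ.* + 1 ℤ.+ (b ℤ.* x ℤ.+ (c ℤ.* y ℤ.+ (d ℤ.* z ℤ.+ 0ℤ)))
                            ≡ a ℤ.+ b ℤ.* x ℤ.+ c ℤ.* y ℤ.+ d ℤ.* z
  flatten = solve-∀

S₃-count : ℕ → ℤ
S₃-count ℓ = + 3 ℤ.* + (2 ^ ℓ) ℤ.+ + (3 ^ ℓ) ℤ.- + 3

S₄-count : ℕ → ℤ
S₄-count ℓ = + 7 ℤ.* + (4 ^ ℓ) ℤ.+ + 4 ℤ.* + (3 ^ ℓ) ℤ.- + 6 ℤ.* + (2 ^ ℓ) ℤ.- + 4

evalExp-1000 : ∀ ℓ → evalExp (1 ∷ 2 ∷ 3 ∷ 4 ∷ []) (+ 1 ∷ 0ℤ ∷ 0ℤ ∷ 0ℤ ∷ []) ℓ ≡ + 1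
evalExp-1000 ℓ = trans (evalExp-1234 (+ 1) 0ℤ 0ℤ 0ℤ ℓ) (simplify (+ (2 ^ ℓ)) (+ (3 ^ ℓ)) (+ (4 ^ ℓ)))
  where
  simplify : ∀ x y z → + 1 ℤ.+ 0ℤ ℤ.* x ℤ.+ 0ℤ ℤ.* y ℤ.+ 0ℤ ℤ.* z ≡ + 1
  simplify = solve-∀

cardC-at0 : ∀ ℓ → + cardC ℓ 0 ≡ + 1
cardC-at0 ℓ = trans (cardC-by-order 0 (from-yes (ByOrder.certified? 0 3 (Sym 0))) ℓ) (evalExp-1000 ℓ)

cardC-at1 : ∀ ℓ → + cardC ℓ 1 ≡ + 1
cardC-at1 ℓ = trans (cardC-by-order 1 (from-yes (ByOrder.certified? 1 3 (Sym 1))) ℓ) (evalExp-1000 ℓ)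

cardC-at2 : ∀ ℓ → + cardC ℓ 2 ≡ + (2 ^ ℓ)
cardC-at2 ℓ = trans (cardC-by-order 2 (from-yes (ByOrder.certified? 2 3 (Sym 2))) ℓ)
  (trans (evalExp-1234 0ℤ (+ 1) 0ℤ 0ℤ ℓ) (simplify (+ (2 ^ ℓ)) (+ (3 ^ ℓ)) (+ (4 ^ ℓ))))
  where
  simplify : ∀ x y z → 0ℤ ℤ.+ + 1 ℤ.* x ℤ.+ 0ℤ ℤ.* y ℤ.+ 0ℤ ℤ.* z ≡ x
  simplify = solve-∀

cardC-at3 : ∀ ℓ → + cardC ℓ 3 ≡ S₃-count ℓ
cardC-at3 ℓ = trans (cardC-by-order 3 (from-yes (ByOrder.certified? 3 3 (Sym 3))) ℓ)
  (trans (evalExp-1234 (ℤ.- + 3) (+ 3) (+ 1) 0ℤ ℓ) (simplify (+ (2 ^ ℓ)) (+ (3 ^ ℓ)) (+ (4 ^ ℓ))))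
  where
  simplify : ∀ x y z → ℤ.- + 3 ℤ.+ + 3 ℤ.* x ℤ.+ + 1 ℤ.* y ℤ.+ 0ℤ ℤ.* z ≡ + 3 ℤ.* x ℤ.+ y ℤ.- + 3
  simplify = solve-∀

cardC-at4 : ∀ ℓ → + cardC ℓ 4 ≡ S₄-count ℓ
cardC-at4 ℓ = trans (cardC-by-order 4 (from-yes (ByOrder.certified? 4 3 (Sym 4))) ℓ)
  (trans (evalExp-1234 (ℤ.- + 4) (ℤ.- + 6) (+ 4) (+ 7) ℓ) (simplify (+ (2 ^ ℓ)) (+ (3 ^ ℓ)) (+ (4 ^ ℓ))))
  where
  simplify : ∀ x y z → ℤ.- + 4 ℤ.+ ℤ.- + 6 ℤ.* x ℤ.+ + 4 ℤ.* y ℤ.+ + 7 ℤ.* z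
                     ≡ + 7 ℤ.* z ℤ.+ + 4 ℤ.* y ℤ.- + 6 ℤ.* x ℤ.- + 4
  simplify = solve-∀

-- Exponential inequalities

≤-by-excess : ∀ {m n} d → m + d ≡ n → m ≤ n
≤-by-excess d refl = m≤m+n _ d

<-by-growth-rates : (f g : ℕ → ℕ) (a ℓ₀ : ℕ) .{{_ : NonZero a}} →
  f ℓ₀ < g ℓ₀ →
  (∀ ℓ → ℓ₀ ≤ ℓ → f (suc ℓ) ≤ a * f ℓ) →
  (∀ ℓ → ℓ₀ ≤ ℓ → a * g ℓ ≤ g (suc ℓ)) →
  ∀ ℓ → ℓ₀ ≤ ℓ → f ℓ < g ℓ
<-by-growth-rates f g a ℓ₀ base f-step g-step = go
  where
  go : ∀ ℓ → ℓ₀ ≤ ℓ → f ℓ < g ℓ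
  go ℓ ℓ₀≤ℓ with m≤n⇒m<n∨m≡n ℓ₀≤ℓ
  go ℓ       _ | inj₂ refl       = base
  go (suc ℓ) _ | inj₁ (s≤s ℓ₀≤ℓ) = begin-strict
    f (suc ℓ)  ≤⟨ f-step ℓ ℓ₀≤ℓ ⟩
    a * f ℓ    <⟨ *-monoʳ-< a (go ℓ ℓ₀≤ℓ) ⟩
    a * g ℓ    ≤⟨ g-step ℓ ℓ₀≤ℓ ⟩
    g (suc ℓ)  ∎
    where open ≤-Reasoning

2<2^ : ∀ ℓ → 2 ≤ ℓ → 2 < 2 ^ ℓ
2<2^ ℓ 2≤ℓ = <-≤-trans (<ᵇ⇒< 2 4 _) (^-monoʳ-≤ 2 2≤ℓ)

6*2^<3^ : ∀ ℓ → 5 ≤ ℓ → 6 * 2 ^ ℓ < 3 ^ ℓ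
6*2^<3^ = <-by-growth-rates (λ ℓ → 6 * 2 ^ ℓ) (3 ^_) 2 5 (<ᵇ⇒< _ _ _)
  (λ ℓ _ → ≤-reflexive (f-step (2 ^ ℓ)))
  (λ ℓ _ → ≤-by-excess (3 ^ ℓ) (g-step (3 ^ ℓ)))
  where
  f-step : ∀ x → 6 * (2 * x) ≡ 2 * (6 * x)
  f-step = ℕ-Ring.solve-∀
  g-step : ∀ y → 2 * y + y ≡ 3 * y
  g-step = ℕ-Ring.solve-∀

Δ₂-bound : ∀ ℓ → 2 ≤ ℓ → 12 * 2 ^ ℓ + 4 * 3 ^ ℓ < 6 * 2 ^ ℓ * 2 ^ ℓ
Δ₂-bound = <-by-growth-rates (λ ℓ → 12 * 2 ^ ℓ + 4 * 3 ^ ℓ) (λ ℓ → 6 * 2 ^ ℓ * 2 ^ ℓ) 4 2 (<ᵇ⇒< _ _ _)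
  (λ ℓ _ → ≤-by-excess (24 * 2 ^ ℓ + 4 * 3 ^ ℓ) (f-step (2 ^ ℓ) (3 ^ ℓ)))
  (λ ℓ _ → ≤-reflexive (g-step (2 ^ ℓ)))
  where
  f-step : ∀ x y → (12 * (2 * x) + 4 * (3 * y)) + (24 * x + 4 * y) ≡ 4 * (12 * x + 4 * y)
  f-step = ℕ-Ring.solve-∀
  g-step : ∀ x → 4 * (6 * x * x) ≡ 6 * (2 * x) * (2 * x)
  g-step = ℕ-Ring.solve-∀

Δ₃-bound : ∀ ℓ → 14 ≤ ℓ → 21 * 2 ^ ℓ * 4 ^ ℓ + 24 * 3 ^ ℓ + 60 * 2 ^ ℓ < 4 * 3 ^ ℓ * 3 ^ ℓ + 12 * 2 ^ ℓ * 3 ^ ℓ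
Δ₃-bound = <-by-growth-rates (λ ℓ → 21 * 2 ^ ℓ * 4 ^ ℓ + 24 * 3 ^ ℓ + 60 * 2 ^ ℓ)
                             (λ ℓ → 4 * 3 ^ ℓ * 3 ^ ℓ + 12 * 2 ^ ℓ * 3 ^ ℓ) 8 14 (<ᵇ⇒< _ _ _)
  (λ ℓ _ → ≤-by-excess (120 * 3 ^ ℓ + 360 * 2 ^ ℓ) (f-step (2 ^ ℓ) (3 ^ ℓ) (4 ^ ℓ)))
  g-grows
  where
  f-step : ∀ x y z → (21 * (2 * x) * (4 * z) + 24 * (3 * y) + 60 * (2 * x)) + (120 * y + 360 * x)
                   ≡ 8 * (21 * x * z + 24 * y + 60 * x)
  f-step = ℕ-Ring.solve-∀
  g-grows : ∀ ℓ → 14 ≤ ℓ → 8 * (4 * 3 ^ ℓ * 3 ^ ℓ + 12 * 2 ^ ℓ * 3 ^ ℓ)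
                          ≤ 4 * 3 ^ suc ℓ * 3 ^ suc ℓ + 12 * 2 ^ suc ℓ * 3 ^ suc ℓ
  g-grows ℓ 14≤ℓ = begin
    8 * (4 * y * y + 12 * x * y)                   ≡⟨ split x y ⟩
    32 * y * y + 72 * x * y + 4 * (6 * x) * y      ≤⟨ +-monoʳ-≤ (32 * y * y + 72 * x * y)
                                                        (*-monoˡ-≤ y (*-monoʳ-≤ 4 6x≤y)) ⟩
    32 * y * y + 72 * x * y + 4 * y * y            ≡⟨ merge x y ⟩
    4 * (3 * y) * (3 * y) + 12 * (2 * x) * (3 * y) ∎
    where
    open ≤-Reasoning
    x = 2 ^ ℓ
    y = 3 ^ ℓ
    6x≤y : 6 * x ≤ y
    6x≤y = <⇒≤ (6*2^<3^ ℓ (≤-trans (≤ᵇ⇒≤ 5 14 _) 14≤ℓ))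
    split : ∀ x y → 8 * (4 * y * y + 12 * x * y) ≡ 32 * y * y + 72 * x * y + 4 * (6 * x) * y
    split = ℕ-Ring.solve-∀
    merge : ∀ x y → 32 * y * y + 72 * x * y + 4 * y * y ≡ 4 * (3 * y) * (3 * y) + 12 * (2 * x) * (3 * y)
    merge = ℕ-Ring.solve-∀

-- The sign of Δ

toℚᵘ-/ : ∀ i n .{{_ : NonZero n}} → toℚᵘ (i ℚ./ n) ≃ᵘ i ℚᵘ./ n
toℚᵘ-/ i (suc n) = toℚᵘ-fromℚᵘ (i ℚᵘ./ suc n)

n/n≡1 : ∀ n .{{_ : NonZero n}} → + n ℚ./ n ≡ 1ℚ
n/n≡1 n@(suc _) = toℚᵘ-injective (≃-trans (toℚᵘ-/ (+ n) n) (*≡* (ℤ.*-comm (+ n) (+ 1))))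

fractions-< : ∀ a p a′ p′ b q b′ q′ .{{_ : NonZero p}} .{{_ : NonZero p′}} .{{_ : NonZero q}} .{{_ : NonZero q′}} →
  a ℤ.* a′ ℤ.* + (q * q′) ℤ.< b ℤ.* b′ ℤ.* + (p * p′) → (a ℚ./ p) ℚ.* (a′ ℚ./ p′) <ℚ (b ℚ./ q) ℚ.* (b′ ℚ./ q′)
fractions-< a p@(suc _) a′ p′@(suc _) b q@(suc _) b′ q′@(suc _) h = toℚᵘ-cancel-<
  (<-respˡ-≃ (≃-sym (product a p a′ p′)) (<-respʳ-≃ (≃-sym (product b q b′ q′)) (*<* h)))
  where
  product : ∀ c r c′ r′ .{{_ : NonZero r}} .{{_ : NonZero r′}} →
            toℚᵘ ((c ℚ./ r) ℚ.* (c′ ℚ./ r′)) ≃ᵘ (c ℚᵘ./ r) ℚᵘ.* (c′ ℚᵘ./ r′)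
  product c r c′ r′ = ≃-trans (toℚᵘ-homo-* (c ℚ./ r) (c′ ℚ./ r′)) (ℚᵘ.*-cong (toℚᵘ-/ c r) (toℚᵘ-/ c′ r′))

p<q⇒p-q<0 : ∀ {p q} → p <ℚ q → p ℚ.- q <ℚ 0ℚ
p<q⇒p-q<0 {p} {q} p<q = subst (p ℚ.- q <ℚ_) (+-inverseʳ q) (+-monoˡ-< (ℚ.- q) p<q)

p<q⇒0<q-p : ∀ {p q} → p <ℚ q → 0ℚ <ℚ q ℚ.- p
p<q⇒0<q-p {p} {q} p<q = subst (_<ℚ q ℚ.- p) (+-inverseʳ p) (+-monoˡ-< (ℚ.- p) p<q)

N-as-ratio : ∀ ℓ n → N ℓ n ≡ (+ cardC ℓ n ℚ./ n !) {{n !≢0}}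
N-as-ratio ℓ zero    = cong (ℚ._/ 1) (sym (cardC-at0 ℓ))
N-as-ratio ℓ (suc n) = refl

N₁≡1 : ∀ n → N 1 n ≡ 1ℚ
N₁≡1 n = trans (N-as-ratio 1 n) (trans (cong (λ c → (+ c ℚ./ n !) {{n !≢0}}) cardC₁≡n!) (n/n≡1 (n !) {{n !≢0}}))
  where
  cardC₁≡n! : cardC 1 n ≡ n !
  cardC₁≡n! = trans (commutingCount-one (Sym n)) (length-Sym n)

Δ₁≡0 : ∀ n → Δ 1 n ≡ 0ℚ
Δ₁≡0 n = cong₂ (λ a b → a ℚ.* a ℚ.- b) (N₁≡1 n) (cong₂ ℚ._*_ (N₁≡1 (n ∸ 1)) (N₁≡1 (suc n)))

N*N<N*N : ∀ ℓ i j k l →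
  + cardC ℓ i ℤ.* + cardC ℓ j ℤ.* + (k ! * l !) ℤ.< + cardC ℓ k ℤ.* + cardC ℓ l ℤ.* + (i ! * j !) →
  N ℓ i ℚ.* N ℓ j <ℚ N ℓ k ℚ.* N ℓ l
N*N<N*N ℓ i j k l h = subst₂ _<ℚ_
  (sym (cong₂ ℚ._*_ (N-as-ratio ℓ i) (N-as-ratio ℓ j))) (sym (cong₂ ℚ._*_ (N-as-ratio ℓ k) (N-as-ratio ℓ l)))
  (fractions-< (+ cardC ℓ i) (i !) (+ cardC ℓ j) (j !) (+ cardC ℓ k) (k !) (+ cardC ℓ l) (l !)
               {{i !≢0}} {{j !≢0}} {{k !≢0}} {{l !≢0}} h)

Δ<0 : ∀ ℓ m →
  + cardC ℓ (suc m) ℤ.* + cardC ℓ (suc m) ℤ.* + (m ! * (2 + m) !)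
    ℤ.< + cardC ℓ m ℤ.* + cardC ℓ (2 + m) ℤ.* + (suc m ! * suc m !) →
  Δ ℓ (suc m) <ℚ 0ℚ
Δ<0 ℓ m h = p<q⇒p-q<0 (N*N<N*N ℓ (suc m) (suc m) m (2 + m) h)

0<Δ : ∀ ℓ m →
  + cardC ℓ m ℤ.* + cardC ℓ (2 + m) ℤ.* + (suc m ! * suc m !)
    ℤ.< + cardC ℓ (suc m) ℤ.* + cardC ℓ (suc m) ℤ.* + (m ! * (2 + m) !) →
  0ℚ <ℚ Δ ℓ (suc m)
0<Δ ℓ m h = p<q⇒0<q-p (N*N<N*N ℓ m (2 + m) (suc m) (suc m) h)

<-by-exchange : ∀ {A B : ℤ} {u v : ℕ} → A ℤ.+ + u ≡ B ℤ.+ + v → v < u → A ℤ.< B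
<-by-exchange {A} {B} {u} {v} A+u≡B+v v<u = begin-strict
  A                  ≡⟨ cancel A (+ u) ⟨
  A ℤ.+ + u ℤ.- + u  ≡⟨ cong (ℤ._- + u) A+u≡B+v ⟩
  B ℤ.+ + v ℤ.- + u  <⟨ ℤ.+-monoˡ-< (ℤ.- + u) (ℤ.+-monoʳ-< B (+<+ v<u)) ⟩
  B ℤ.+ + u ℤ.- + u  ≡⟨ cancel B (+ u) ⟩
  B                  ∎
  where
  open ℤ.≤-Reasoning
  cancel : ∀ a u → a ℤ.+ u ℤ.- u ≡ a
  cancel = solve-∀

pos-*-* : ∀ a b c → + (a * b * c) ≡ + a ℤ.* + b ℤ.* + c
pos-*-* a b c = trans (pos-* (a * b) c) (cong (ℤ._* + c) (pos-* a b))

Δ-at1-numerator : ∀ ℓ → 2 ≤ ℓ →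
  + cardC ℓ 1 ℤ.* + cardC ℓ 1 ℤ.* + (0 ! * 2 !) ℤ.< + cardC ℓ 0 ℤ.* + cardC ℓ 2 ℤ.* + (1 ! * 1 !)
Δ-at1-numerator ℓ 2≤ℓ = at-closed-forms (cardC-at0 ℓ) (cardC-at1 ℓ) (cardC-at2 ℓ)
  where
  exchange : ∀ x → + 1 ℤ.* + 1 ℤ.* + 2 ℤ.+ x ≡ + 1 ℤ.* x ℤ.* + 1 ℤ.+ + 2
  exchange = solve-∀
  at-closed-forms : ∀ {c₀ c₁ c₂} → c₀ ≡ + 1 → c₁ ≡ + 1 → c₂ ≡ + (2 ^ ℓ) → c₁ ℤ.* c₁ ℤ.* + 2 ℤ.< c₀ ℤ.* c₂ ℤ.* + 1
  at-closed-forms refl refl refl = <-by-exchange (exchange (+ (2 ^ ℓ))) (2<2^ ℓ 2≤ℓ)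

Δ-at2-numerator : ∀ ℓ → 2 ≤ ℓ →
  + cardC ℓ 1 ℤ.* + cardC ℓ 3 ℤ.* + (2 ! * 2 !) ℤ.< + cardC ℓ 2 ℤ.* + cardC ℓ 2 ℤ.* + (1 ! * 3 !)
Δ-at2-numerator ℓ 2≤ℓ = at-closed-forms (cardC-at1 ℓ) (cardC-at2 ℓ) (cardC-at3 ℓ)
  where
  x = 2 ^ ℓ
  y = 3 ^ ℓ
  exchange : + 1 ℤ.* S₃-count ℓ ℤ.* + 4 ℤ.+ + (6 * x * x + 12) ≡ + x ℤ.* + x ℤ.* + 6 ℤ.+ + (12 * x + 4 * y)
  exchange = begin
    + 1 ℤ.* S₃-count ℓ ℤ.* + 4 ℤ.+ (+ (6 * x * x) ℤ.+ + 12)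
      ≡⟨ cong (λ t → + 1 ℤ.* S₃-count ℓ ℤ.* + 4 ℤ.+ (t ℤ.+ + 12)) (pos-*-* 6 x x) ⟩
    + 1 ℤ.* S₃-count ℓ ℤ.* + 4 ℤ.+ (+ 6 ℤ.* + x ℤ.* + x ℤ.+ + 12)
      ≡⟨ identity (+ x) (+ y) ⟩
    + x ℤ.* + x ℤ.* + 6 ℤ.+ (+ 12 ℤ.* + x ℤ.+ + 4 ℤ.* + y)
      ≡⟨ cong (λ t → + x ℤ.* + x ℤ.* + 6 ℤ.+ t) (cong₂ ℤ._+_ (pos-* 12 x) (pos-* 4 y)) ⟨
    + x ℤ.* + x ℤ.* + 6 ℤ.+ (+ (12 * x) ℤ.+ + (4 * y)) ∎
    where
    open ≡-Reasoning
    identity : ∀ x y → + 1 ℤ.* (+ 3 ℤ.* x ℤ.+ y ℤ.- + 3) ℤ.* + 4 ℤ.+ (+ 6 ℤ.* x ℤ.* x ℤ.+ + 12)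
                     ≡ x ℤ.* x ℤ.* + 6 ℤ.+ (+ 12 ℤ.* x ℤ.+ + 4 ℤ.* y)
    identity = solve-∀
  at-closed-forms : ∀ {c₁ c₂ c₃} → c₁ ≡ + 1 → c₂ ≡ + x → c₃ ≡ S₃-count ℓ → c₁ ℤ.* c₃ ℤ.* + 4 ℤ.< c₂ ℤ.* c₂ ℤ.* + 6
  at-closed-forms refl refl refl = <-by-exchange exchange (<-≤-trans (Δ₂-bound ℓ 2≤ℓ) (m≤m+n _ 12))

Δ-at3-numerator-small : ∀ ℓ → 2 ≤ ℓ → ℓ ≤ 13 →
  + cardC ℓ 3 ℤ.* + cardC ℓ 3 ℤ.* + (2 ! * 4 !) ℤ.< + cardC ℓ 2 ℤ.* + cardC ℓ 4 ℤ.* + (3 ! * 3 !)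
Δ-at3-numerator-small ℓ 2≤ℓ ℓ≤13 = at-closed-forms (cardC-at2 ℓ) (cardC-at3 ℓ) (cardC-at4 ℓ)
  where
  P : ℕ → Set
  P ℓ = S₃-count ℓ ℤ.* S₃-count ℓ ℤ.* + 48 ℤ.< + (2 ^ ℓ) ℤ.* S₄-count ℓ ℤ.* + 36
  P? : ∀ ℓ → Dec (P ℓ)
  P? ℓ = S₃-count ℓ ℤ.* S₃-count ℓ ℤ.* + 48 ℤ.<? + (2 ^ ℓ) ℤ.* S₄-count ℓ ℤ.* + 36
  checked : ∀ (i : Fin 12) → P (2 + toℕ i)
  checked = from-yes (Fin.all? {n = 12} (λ i → P? (2 + toℕ i)))
  ℓ∸2<12 : ℓ ∸ 2 < 12
  ℓ∸2<12 = s≤s (∸-monoˡ-≤ 2 ℓ≤13)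
  at-closed-forms : ∀ {c₂ c₃ c₄} → c₂ ≡ + (2 ^ ℓ) → c₃ ≡ S₃-count ℓ → c₄ ≡ S₄-count ℓ →
                    c₃ ℤ.* c₃ ℤ.* + 48 ℤ.< c₂ ℤ.* c₄ ℤ.* + 36
  at-closed-forms refl refl refl =
    subst P (trans (cong (λ k → 2 + k) (Fin.toℕ-fromℕ< ℓ∸2<12)) (m+[n∸m]≡n 2≤ℓ)) (checked (fromℕ< ℓ∸2<12))

Δ-at3-numerator-large : ∀ ℓ → 14 ≤ ℓ →
  + cardC ℓ 2 ℤ.* + cardC ℓ 4 ℤ.* + (3 ! * 3 !) ℤ.< + cardC ℓ 3 ℤ.* + cardC ℓ 3 ℤ.* + (2 ! * 4 !)
Δ-at3-numerator-large ℓ 14≤ℓ = at-closed-forms (cardC-at2 ℓ) (cardC-at3 ℓ) (cardC-at4 ℓ)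
  where
  x = 2 ^ ℓ
  y = 3 ^ ℓ
  z = 4 ^ ℓ
  u = 12 * ((4 * y * y + 12 * x * y) + (54 * x * x + 36))
  v = 12 * (21 * x * z + 24 * y + 60 * x)
  exchange : + x ℤ.* S₄-count ℓ ℤ.* + 36 ℤ.+ + u ≡ S₃-count ℓ ℤ.* S₃-count ℓ ℤ.* + 48 ℤ.+ + v
  exchange = begin
    + x ℤ.* S₄-count ℓ ℤ.* + 36 ℤ.+ + u
      ≡⟨ cong (λ t → + x ℤ.* S₄-count ℓ ℤ.* + 36 ℤ.+ t) cast-u ⟩
    + x ℤ.* S₄-count ℓ ℤ.* + 36 ℤ.+ + 12 ℤ.* ((+ 4 ℤ.* + y ℤ.* + y ℤ.+ + 12 ℤ.* + x ℤ.* + y) ℤ.+ (+ 54 ℤ.* + x ℤ.* + x ℤ.+ + 36))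
      ≡⟨ identity (+ x) (+ y) (+ z) ⟩
    S₃-count ℓ ℤ.* S₃-count ℓ ℤ.* + 48 ℤ.+ + 12 ℤ.* (+ 21 ℤ.* + x ℤ.* + z ℤ.+ + 24 ℤ.* + y ℤ.+ + 60 ℤ.* + x)
      ≡⟨ cong (λ t → S₃-count ℓ ℤ.* S₃-count ℓ ℤ.* + 48 ℤ.+ t) cast-v ⟨
    S₃-count ℓ ℤ.* S₃-count ℓ ℤ.* + 48 ℤ.+ + v ∎
    where
    open ≡-Reasoning
    cast-u : + u ≡ + 12 ℤ.* ((+ 4 ℤ.* + y ℤ.* + y ℤ.+ + 12 ℤ.* + x ℤ.* + y) ℤ.+ (+ 54 ℤ.* + x ℤ.* + x ℤ.+ + 36))
    cast-u = trans (pos-* 12 ((4 * y * y + 12 * x * y) + (54 * x * x + 36)))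
      (cong (+ 12 ℤ.*_) (cong₂ ℤ._+_ (cong₂ ℤ._+_ (pos-*-* 4 y y) (pos-*-* 12 x y)) (cong (ℤ._+ + 36) (pos-*-* 54 x x))))
    cast-v : + v ≡ + 12 ℤ.* (+ 21 ℤ.* + x ℤ.* + z ℤ.+ + 24 ℤ.* + y ℤ.+ + 60 ℤ.* + x)
    cast-v = trans (pos-* 12 (21 * x * z + 24 * y + 60 * x))
      (cong (+ 12 ℤ.*_) (cong₂ ℤ._+_ (cong₂ ℤ._+_ (pos-*-* 21 x z) (pos-* 24 y)) (pos-* 60 x)))
    identity : ∀ x y z →
      x ℤ.* (+ 7 ℤ.* z ℤ.+ + 4 ℤ.* y ℤ.- + 6 ℤ.* x ℤ.- + 4) ℤ.* + 36
        ℤ.+ + 12 ℤ.* ((+ 4 ℤ.* y ℤ.* y ℤ.+ + 12 ℤ.* x ℤ.* y) ℤ.+ (+ 54 ℤ.* x ℤ.* x ℤ.+ + 36))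
      ≡ (+ 3 ℤ.* x ℤ.+ y ℤ.- + 3) ℤ.* (+ 3 ℤ.* x ℤ.+ y ℤ.- + 3) ℤ.* + 48
        ℤ.+ + 12 ℤ.* (+ 21 ℤ.* x ℤ.* z ℤ.+ + 24 ℤ.* y ℤ.+ + 60 ℤ.* x)
    identity = solve-∀
  at-closed-forms : ∀ {c₂ c₃ c₄} → c₂ ≡ + x → c₃ ≡ S₃-count ℓ → c₄ ≡ S₄-count ℓ →
                    c₂ ℤ.* c₄ ℤ.* + 36 ℤ.< c₃ ℤ.* c₃ ℤ.* + 48
  at-closed-forms refl refl refl =
    <-by-exchange exchange (*-monoʳ-< 12 (<-≤-trans (Δ₃-bound ℓ 14≤ℓ) (m≤m+n _ _)))

lemma2p1 : ((n : ℕ) → 1 ≤ n → Δ 1 n ≡ 0ℚ)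
           × ((ℓ : ℕ) → 1 < ℓ → (Δ ℓ 1 <ℚ 0ℚ) × (0ℚ <ℚ Δ ℓ 2))
           × ((ℓ : ℕ) → 2 ≤ ℓ → ℓ ≤ 13 → Δ ℓ 3 <ℚ 0ℚ)
           × ((ℓ : ℕ) → 14 ≤ ℓ → 0ℚ <ℚ Δ ℓ 3)
lemma2p1 =
  (λ n _ → Δ₁≡0 n) ,
  (λ ℓ 2≤ℓ → Δ<0 ℓ 0 (Δ-at1-numerator ℓ 2≤ℓ) , 0<Δ ℓ 1 (Δ-at2-numerator ℓ 2≤ℓ)) ,
  (λ ℓ 2≤ℓ ℓ≤13 → Δ<0 ℓ 2 (Δ-at3-numerator-small ℓ 2≤ℓ ℓ≤13)) ,
  (λ ℓ 14≤ℓ → 0<Δ ℓ 2 (Δ-at3-numerator-large ℓ 14≤ℓ))
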